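{- Let $\Sigma$ be a ranked alphabet and $k\ge1$. For every (nondeterministic) $k$-head tree-walking automaton with nested pebbles $\mathcal A$ over $\Sigma$ there is a closed formula $\phi$ of FO+TC$^k$ over $\Sigma$ with $L(\mathcal A)=\{t\in T_\Sigma\mid t\models\phi\}$. That is, $\mathrm{NPTWA}^k\subseteq\mathrm{FO{+}TC}^k$.
   Context: Trees: a ranked alphabet is a finite set $\Sigma$ with a map $\mathrm{rank}:\Sigma\to\mathbb{N}$; $T_\Sigma$ is the set of trees over $\Sigma$, a node labelled $\sigma$ having exactly $\mathrm{rank}(\sigma)$ children numbered $1,\dots,\mathrm{rank}(\sigma)$ (the root has child number $0$). Logic: first-order logic over $\Sigma$ has node variables, atomic formulas $\mathrm{lab}_\sigma(x)$, $\mathrm{edg}_i(x,y)$ ($y$ is the $i$-th child of $x$), $x\le y$ ($x$ is an ancestor of $y$), $x=y$, closed under $\neg,\wedge,\vee,\exists,\forall$. FO+TC$^k$ adds $k$-ary transitive closure: for a formula $\phi$ with $k$-tuples $\bar x,\bar y$ of distinct free variables (other free variables fixed), $t\models\phi^*(\bar u,\bar v)$ iff there are $k$-tuples of nodes $\bar u_0=\bar u,\dots,\bar u_n=\bar v$ ($n\ge0$) with $t\models\phi(\bar u_i,\bar u_{i+1})$ for all $i<n$. Automata: a $k$-head tree-walking automaton with nested pebbles is $\mathcal A=(Q,\Sigma,X,q_0,A,I)$: finite states $Q$, finite pebble set $X$, initial state $q_0$, accepting states $A$, finite set $I$ of instructions $\langle p,\chi,q\rangle$ with $\chi$ one of $\mathrm{up}_i$,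 $\mathrm{down}_{i,j}$, $\mathrm{drop}_i(x)$, $\mathrm{retrieve}(x)$, $\mathrm{lab}_{i,\sigma}$, $\mathrm{peb}_i(x)$, $\mathrm{chno}_{i,j}$ or a negated test $\neg\mathrm{lab}_{i,\sigma}$, $\neg\mathrm{peb}_i(x)$, $\neg\mathrm{chno}_{i,j}$ ($1\le i\le k$ a head, $x\in X$). Configurations: $[p,\bar u,\alpha]$ with state, $k$-tuple of head nodes, stack $\alpha$ of (pebble,node) pairs. Semantics: $\mathrm{up}_i$/$\mathrm{down}_{i,j}$ move head $i$ to the parent/$j$-th child; $\mathrm{drop}_i(x)$ pushes $(x,u[i])$ if $x$ is not on the stack; $\mathrm{retrieve}(x)$ pops the top pair if its pebble is $x$, regardless of head positions; tests check the label of $u[i]$, presence of $(x,u[i])$ on the stack, or child number of $u[i]$ (negated tests succeed iff the test fails) and change nothing. A configuration is halting if no instruction applies. $t\in L(\mathcal A)$ iff from $[q_0,\overline{\mathrm{root}},\varepsilon]$ some halting configuration $[p,\overline{\mathrm{root}},\varepsilon]$ with $p\in A$ is reachable. $\mathrm{NPTWA}^k$ is the family of languages accepted by such automata. -}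

module Defs where

open import Data.Nat using (ℕ; zero; suc)
open import Data.Fin using (Fin; toℕ)
open import Data.Bool using (Bool; true)
open import Data.Product using (Σ; _×_; _,_; proj₁)
open import Data.Sum using (_⊎_)
open import Data.Empty using (⊥)
open import Data.List using (List; []; _∷_; map)
open import Data.List.Membership.Propositional using (_∈_)
open import Data.Vec using (Vec; lookup; _[_]≔_; replicate)
import Data.Vec as Vec
import Data.Vec.Functional as VF
open import Relation.Nullary using (¬_)
open import Relation.Binary.PropositionalEquality using (_≡_)
open import Relation.Binary.Construct.Closure.ReflexiveTransitive using (Star)

record RankedAlphabet : Set where
  field
    size : ℕ
    rank : Fin size → ℕ

module _ (Σ' : RankedAlphabet) where
  open RankedAlphabet Σ'

  Sym : Set
  Sym = Fin size

  data Tree : Set where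
    node : (σ : Fin size) → (Fin (rank σ) → Tree) → Tree

  -- nodes of a tree, as paths from the root
  -- child i p : the node p inside the subtree rooted at the (toℕ i + 1)-th child of the root
  data Pos : Tree → Set where
    here  : ∀ {t} → Pos t
    child : ∀ {σ f} (i : Fin (rank σ)) → Pos (f i) → Pos (node σ f)

  root : ∀ {t} → Pos t
  root = here

  label : ∀ {t} → Pos t → Fin size
  label {node σ f} here        = σ
  label {node σ f} (child i p) = label p

  -- Edge j u v : v is the j-th child of u  (children numbered 1 .. rank)
  data Edge : ∀ {t} → ℕ → Pos t → Pos t → Set where
    edge-root : ∀ {σ f} (i : Fin (rank σ)) →
                Edge {node σ f} (suc (toℕ i)) here (child i here)
    edge-in   : ∀ {σ f} (i : Fin (rank σ)) {j u v} →
                Edge {f i} j u v → Edge {node σ f} j (child i u) (child i v)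

  data Anc : ∀ {t} → Pos t → Pos t → Set where
    anc-here  : ∀ {t} {v : Pos t} → Anc here v
    anc-child : ∀ {σ f} (i : Fin (rank σ)) {u v} →
                Anc {f i} u v → Anc {node σ f} (child i u) (child i v)

  -- child number: 0 for the root, j for a j-th child
  chnoAux : ∀ {t} → ℕ → Pos t → ℕ
  chnoAux acc here        = acc
  chnoAux acc (child i p) = chnoAux (suc (toℕ i)) p

  chno : ∀ {t} → Pos t → ℕ
  chno = chnoAux 0

  -- FO+TC^k formulas, well-scoped: Formula k n has free variables Fin n.
  -- tc φ us vs  is  φ*(us, vs), where in φ the variables 0..k-1 form x̄,
  -- the variables k..2k-1 form ȳ, and the remaining n are the parameters.

  data Formula (k : ℕ) : ℕ → Set where
    lab  : ∀ {n} → Fin size → Fin n → Formula k n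
    edg  : ∀ {n} → ℕ → Fin n → Fin n → Formula k n
    leq  : ∀ {n} → Fin n → Fin n → Formula k n
    eq   : ∀ {n} → Fin n → Fin n → Formula k n
    neg  : ∀ {n} → Formula k n → Formula k n
    and  : ∀ {n} → Formula k n → Formula k n → Formula k n
    or   : ∀ {n} → Formula k n → Formula k n → Formula k n
    ex   : ∀ {n} → Formula k (suc n) → Formula k n
    all  : ∀ {n} → Formula k (suc n) → Formula k n
    tc   : ∀ {n} → Formula k (k Data.Nat.+ k Data.Nat.+ n) →
           Vec (Fin n) k → Vec (Fin n) k → Formula k n

  Sat : ∀ {k n} (t : Tree) → Formula k n → (Fin n → Pos t) → Set
  Sat t (lab σ x)   ρ = label (ρ x) ≡ σ
  Sat t (edg i x y) ρ = Edge i (ρ x) (ρ y)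
  Sat t (leq x y)   ρ = Anc (ρ x) (ρ y)
  Sat t (eq x y)    ρ = ρ x ≡ ρ y
  Sat t (neg φ)     ρ = ¬ Sat t φ ρ
  Sat t (and φ ψ)   ρ = Sat t φ ρ × Sat t ψ ρ
  Sat t (or φ ψ)    ρ = Sat t φ ρ ⊎ Sat t ψ ρ
  Sat t (ex φ)      ρ = Σ (Pos t) λ u → Sat t φ (u VF.∷ ρ)
  Sat t (all φ)     ρ = (u : Pos t) → Sat t φ (u VF.∷ ρ)
  Sat t (tc φ us vs) ρ =
    Star (λ a b → Sat t φ ((lookup a VF.++ lookup b) VF.++ ρ))
         (Vec.map ρ us) (Vec.map ρ vs)

  _⊨_ : ∀ {k} → Tree → Formula k 0 → Set
  t ⊨ φ = Sat t φ (λ ())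

  -- k-head tree-walking automata with nested pebbles.
  -- Heads 1..k are Fin k; pebbles are Fin nX; child numbers are 1-based ℕ.

  data Instr (k nX : ℕ) : Set where
    up       : Fin k → Instr k nX
    down     : Fin k → ℕ → Instr k nX
    drop     : Fin k → Fin nX → Instr k nX
    retrieve : Fin nX → Instr k nX
    labT     : Fin k → Fin size → Instr k nX
    pebT     : Fin k → Fin nX → Instr k nX
    chnoT    : Fin k → ℕ → Instr k nX
    nlabT    : Fin k → Fin size → Instr k nX
    npebT    : Fin k → Fin nX → Instr k nX
    nchnoT   : Fin k → ℕ → Instr k nX

  record Automaton (k : ℕ) : Set where
    field
      nQ     : ℕ
      nX     : ℕ
      q₀     : Fin nQ
      accept : Fin nQ → Bool
      instrs : List (Fin nQ × Instr k nX × Fin nQ)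

  -- stacks: head of the list is the top of the stack
  Stack : ℕ → Tree → Set
  Stack nX t = List (Fin nX × Pos t)

  data Apply {k nX : ℕ} {t : Tree} :
       Instr k nX → Vec (Pos t) k → Stack nX t → Vec (Pos t) k → Stack nX t → Set where
    ap-up    : ∀ {i j u v α} → Edge j v (lookup u i) →
               Apply (up i) u α (u [ i ]≔ v) α
    ap-down  : ∀ {i j u v α} → Edge j (lookup u i) v →
               Apply (down i j) u α (u [ i ]≔ v) α
    ap-drop  : ∀ {i x u α} → ¬ (x ∈ map proj₁ α) →
               Apply (drop i x) u α u ((x , lookup u i) ∷ α)
    ap-retr  : ∀ {x w u α} →
               Apply (retrieve x) u ((x , w) ∷ α) u α
    ap-lab   : ∀ {i σ u α} → label (lookup u i) ≡ σ → Apply (labT i σ) u α u α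
    ap-peb   : ∀ {i x u α} → (x , lookup u i) ∈ α → Apply (pebT i x) u α u α
    ap-chno  : ∀ {i j u α} → chno (lookup u i) ≡ j → Apply (chnoT i j) u α u α
    ap-nlab  : ∀ {i σ u α} → ¬ (label (lookup u i) ≡ σ) → Apply (nlabT i σ) u α u α
    ap-npeb  : ∀ {i x u α} → ¬ ((x , lookup u i) ∈ α) → Apply (npebT i x) u α u α
    ap-nchno : ∀ {i j u α} → ¬ (chno (lookup u i) ≡ j) → Apply (nchnoT i j) u α u α

  module _ {k : ℕ} (𝒜 : Automaton k) (t : Tree) where
    open Automaton 𝒜

    record Config : Set where
      constructor [_,_,_]
      field
        state : Fin nQ
        heads : Vec (Pos t) k
        stack : Stack nX t

    data Step : Config → Config → Set where
      step : ∀ {p χ q u α u′ α′} → (p , χ , q) ∈ instrs → Apply χ u α u′ α′ →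
             Step [ p , u , α ] [ q , u′ , α′ ]

    Halting : Config → Set
    Halting c = ∀ c′ → ¬ Step c c′

    Accepts : Set
    Accepts = Σ (Fin nQ) λ p →
      accept p ≡ true ×
      Star Step [ q₀ , replicate k root , [] ] [ p , replicate k root , [] ] ×
      Halting [ p , replicate k root , [] ]

module Submission where

-- Runs of a pebble automaton from the empty stack back to the empty stack are cut at
-- matching drop/retrieve pairs: a run that never pops the stack α and nests at most n
-- further pebbles is a sequence of macro steps, each either one stack-preserving
-- instruction or a drop, a run on the extended stack nesting at most n − 1 pebbles, and the
-- matching retrieve. Pebbles on a stack are distinct, so n = |X| suffices at the empty stack.
--
-- With the pebble names on the stack fixed and their positions as parameters, one
-- stack-preserving instruction between two given states is a first-order relation between
-- k-tuples of head positions. The reflexive-transitive closure of a finite-state family of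
-- definable relations on k-tuples is again definable by Kleene's elimination of states; the
-- loops at an eliminated state are where k-ary TC is used. Induction on the nesting depth
-- defines the runs, and acceptance adds the first-order halting condition at the root.

open import Defs
open import Data.Nat using (ℕ; _≤_)
open import Data.Product using (Σ)
open import Function.Bundles using (_⇔_)

open import Data.Bool using (T; true)
import Data.Bool.Properties as Bool
open import Data.Empty using (⊥; ⊥-elim)
open import Data.Fin as Fin using (Fin; zero; suc; toℕ; splitAt; lift; _↑ˡ_; _↑ʳ_)
import Data.Fin.Properties as Fin
open import Data.List as List using (List; []; _∷_; length)
open import Data.List.Membership.Propositional using (_∈_; _∉_)
open import Data.List.Membership.Propositional.Properties using (∈-lookup; ∈-allFin)
open import Data.List.Properties using (length-map)
open import Data.List.Relation.Binary.Subset.Propositional using (_⊆_)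
open import Data.List.Relation.Unary.All as All using (All)
open import Data.List.Relation.Unary.All.Properties using (¬Any⇒All¬)
open import Data.List.Relation.Unary.AllPairs using ([]; _∷_)
open import Data.List.Relation.Unary.Any using (here; there)
open import Data.List.Relation.Unary.Unique.Propositional using (Unique)
open import Data.Maybe using (Maybe; just; nothing; is-just)
open import Data.Nat using (zero; suc; _+_)
open import Data.Nat.Properties using (0≢1+n; 1+n≰n; +-suc; +-identityʳ; ≤-refl; <⇒≤)
open import Data.Product using (_×_; _,_; proj₁)
import Data.Product as Product
open import Data.Product.Function.NonDependent.Propositional using (_×-⇔_)
open import Data.Sum using (_⊎_; inj₁; inj₂; [_,_]′)
open import Data.Sum.Function.Propositional using (_⊎-⇔_)
open import Data.Sum.Properties using ([,]-map; [,]-∘)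
open import Data.Unit using (tt)
open import Data.Vec as Vec using (Vec; []; _∷_; lookup; tabulate; replicate)
open import Data.Vec.Properties
  using (map-∘; map-cong; map-[]≔; ∷-injective; lookup-replicate; tabulate-∘; tabulate-cong; tabulate∘lookup)
import Data.Vec.Functional as VF
open import Data.Vec.Functional.Properties using (lookup-++ˡ; lookup-++ʳ; ++-cong)
open import Function using (_∘_; id)
open import Function.Bundles using (mk⇔; Equivalence)
open import Function.Construct.Identity using (⇔-id)
open import Function.Definitions using (Injective)
open import Function.Properties.Equivalence using () renaming (trans to ⇔-trans; sym to ⇔-sym)
open import Function.Related.TypeIsomorphisms using (¬-cong-⇔)
open import Relation.Binary.Construct.Closure.ReflexiveTransitive as Star using (Star; ε; _◅_; _◅◅_)
open import Relation.Binary.PropositionalEquality hiding ([_])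
open import Relation.Nullary using (¬_; contradiction; Dec; yes; no)
open import Relation.Nullary.Decidable using (T?)

open Equivalence using (to; from)

module _ {A : Set} where

  cong-⇔ : (P : A → Set) {x y : A} → x ≡ y → P x ⇔ P y
  cong-⇔ P refl = ⇔-id _

  Σ-cong-⇔ : {P Q : A → Set} → (∀ x → P x ⇔ Q x) → Σ A P ⇔ Σ A Q
  Σ-cong-⇔ P⇔Q = mk⇔ (Product.map₂ λ {x} → to (P⇔Q x)) (Product.map₂ λ {x} → from (P⇔Q x))

  Π-cong-⇔ : {P Q : A → Set} → (∀ x → P x ⇔ Q x) → (∀ x → P x) ⇔ (∀ x → Q x)
  Π-cong-⇔ P⇔Q = mk⇔ (λ f x → to (P⇔Q x) (f x)) (λ g x → from (P⇔Q x) (g x))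

  Star-cong-⇔ : {R S : A → A → Set} → (∀ x y → R x y ⇔ S x y) →
                ∀ {x x′ y y′} → x ≡ x′ → y ≡ y′ → Star R x y ⇔ Star S x′ y′
  Star-cong-⇔ R⇔S refl refl =
    mk⇔ (Star.map λ {x} {y} → to (R⇔S x y)) (Star.map λ {x} {y} → from (R⇔S x y))

cong₂-⇔ : {A B : Set} (P : A → B → Set) {x x′ : A} {y y′ : B} → x ≡ x′ → y ≡ y′ → P x y ⇔ P x′ y′
cong₂-⇔ P refl refl = ⇔-id _

module _ {A : Set} where

  ++-suc : ∀ {m n} (σ : Fin (suc m) → A) (ρ : Fin n → A) i →
           (σ VF.++ ρ) (suc i) ≡ ((σ ∘ suc) VF.++ ρ) i
  ++-suc {m} σ ρ i = [,]-map (splitAt m i)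

  ∷-lift : ∀ {n n′} (u : A) {ρ : Fin n′ → A} {ρ′ : Fin n → A} {f : Fin n → Fin n′} →
           ρ ∘ f ≗ ρ′ → (u VF.∷ ρ) ∘ lift 1 f ≗ u VF.∷ ρ′
  ∷-lift u h zero    = refl
  ∷-lift u h (suc i) = h i

  ++-lift : ∀ m {n n′} (σ : Fin m → A) {ρ : Fin n′ → A} {ρ′ : Fin n → A} {f : Fin n → Fin n′} →
            ρ ∘ f ≗ ρ′ → (σ VF.++ ρ) ∘ lift m f ≗ σ VF.++ ρ′
  ++-lift zero    σ h i    = h i
  ++-lift (suc m) σ h zero = refl
  ++-lift (suc m) σ {ρ} {ρ′} {f} h (suc i) = begin
    (σ VF.++ ρ) (suc (lift m f i))    ≡⟨ ++-suc σ ρ (lift m f i) ⟩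
    ((σ ∘ suc) VF.++ ρ) (lift m f i)  ≡⟨ ++-lift m (σ ∘ suc) h i ⟩
    ((σ ∘ suc) VF.++ ρ′) i            ≡⟨ ++-suc σ ρ′ i ⟨
    (σ VF.++ ρ′) (suc i)              ∎
    where open ≡-Reasoning

  Unique⇒lookup-injective : {xs : List A} → Unique xs → Injective _≡_ _≡_ (List.lookup xs)
  Unique⇒lookup-injective {_ ∷ _} (_ ∷ _)  {zero}  {zero}  _ = refl
  Unique⇒lookup-injective {_ ∷ _} (x∉ ∷ _) {zero}  {suc j} p =
    contradiction p (All.lookup x∉ (∈-lookup j))
  Unique⇒lookup-injective {_ ∷ _} (x∉ ∷ _) {suc i} {zero}  p =
    contradiction (sym p) (All.lookup x∉ (∈-lookup i))
  Unique⇒lookup-injective {_ ∷ _} (_ ∷ u)  {suc i} {suc j} p =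
    cong suc (Unique⇒lookup-injective u p)

Unique⇒length≤ : ∀ {N} {xs : List (Fin N)} → Unique xs → length xs ≤ N
Unique⇒length≤ u = Fin.injective⇒≤ (Unique⇒lookup-injective u)

map-tabulate-≗ : ∀ {A B : Set} {r} (ρ : A → B) {f : Fin r → A} {a : Vec B r} →
                 ρ ∘ f ≗ lookup a → Vec.map ρ (tabulate f) ≡ a
map-tabulate-≗ ρ {f} {a} h = trans (sym (tabulate-∘ ρ f)) (trans (tabulate-cong h) (tabulate∘lookup a))

module Kleene {S A : Set} (M : S → S → A → A → Set) where

  Transition : S × A → S × A → Set
  Transition (p , a) (q , b) = M p q a b

  infixr 5 _∷⟨_⟩_

  data Path (L : List S) : S → A → S → A → Set where
    [_]    : ∀ {p a q b} → M p q a b → Path L p a q b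
    _∷⟨_⟩_ : ∀ {p a r c q b} → M p r a c → r ∈ L → Path L r c q b → Path L p a q b

  module _ {L : List S} where

    infixr 5 _++⟨_⟩_

    _++⟨_⟩_ : ∀ {p a r c q b} → Path L p a r c → r ∈ L → Path L r c q b → Path L p a q b
    [ m ]          ++⟨ r∈ ⟩ π = m ∷⟨ r∈ ⟩ π
    (m ∷⟨ s∈ ⟩ π′) ++⟨ r∈ ⟩ π = m ∷⟨ s∈ ⟩ (π′ ++⟨ r∈ ⟩ π)

    Path-mono : ∀ {L′ p a q b} → L ⊆ L′ → Path L p a q b → Path L′ p a q b
    Path-mono L⊆L′ [ m ]         = [ m ]
    Path-mono L⊆L′ (m ∷⟨ r∈ ⟩ π) = m ∷⟨ L⊆L′ r∈ ⟩ Path-mono L⊆L′ π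

    Path⇒Star : ∀ {p a q b} → Path L p a q b → Star Transition (p , a) (q , b)
    Path⇒Star [ m ]        = m ◅ ε
    Path⇒Star (m ∷⟨ _ ⟩ π) = m ◅ Path⇒Star π

    Star⇔Path : (∀ r → r ∈ L) → ∀ {p a q b} →
                Star Transition (p , a) (q , b) ⇔ ((p ≡ q × a ≡ b) ⊎ Path L p a q b)
    Star⇔Path every = mk⇔ split [ (λ { (refl , refl) → ε }) , Path⇒Star ]′
      where
      split : ∀ {p a q b} → Star Transition (p , a) (q , b) → (p ≡ q × a ≡ b) ⊎ Path L p a q b
      split ε = inj₁ (refl , refl)
      split (_◅_ {j = r , _} m steps) with split steps
      ... | inj₁ (refl , refl) = inj₂ [ m ]
      ... | inj₂ π             = inj₂ (m ∷⟨ every r ⟩ π)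

  Path-[] : ∀ {p a q b} → Path [] p a q b ⇔ M p q a b
  Path-[] = mk⇔ (λ { [ m ] → m ; (_ ∷⟨ () ⟩ _) }) [_]

  Through : S → List S → S → A → S → A → Set
  Through j L p a q b =
    Σ A λ c → Path L p a j c × Σ A λ d → Star (λ c d → Path L j c j d) c d × Path L j d q b

  Path-∷ : ∀ {j L p a q b} → Path (j ∷ L) p a q b ⇔ (Path L p a q b ⊎ Through j L p a q b)
  Path-∷ {j} {L} = mk⇔ split join
    where
    split : ∀ {p a q b} → Path (j ∷ L) p a q b → Path L p a q b ⊎ Through j L p a q b
    split [ m ] = inj₁ [ m ]
    split (_∷⟨_⟩_ {c = c} m (here refl) π) with split π
    ... | inj₁ π′                        = inj₂ (c , [ m ] , c , ε , π′)
    ... | inj₂ (_ , π₁ , d , loops , π₂) = inj₂ (c , [ m ] , d , π₁ ◅ loops , π₂)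
    split (m ∷⟨ there r∈ ⟩ π) with split π
    ... | inj₁ π′                        = inj₁ (m ∷⟨ r∈ ⟩ π′)
    ... | inj₂ (c , π₁ , d , loops , π₂) = inj₂ (c , m ∷⟨ r∈ ⟩ π₁ , d , loops , π₂)

    widen : ∀ {p a q b} → Path L p a q b → Path (j ∷ L) p a q b
    widen = Path-mono there

    loop : ∀ {c d q b} → Star (λ c d → Path L j c j d) c d → Path (j ∷ L) j d q b → Path (j ∷ L) j c q b
    loop ε        π = π
    loop (π₁ ◅ πs) π = widen π₁ ++⟨ here refl ⟩ loop πs π

    join : ∀ {p a q b} → Path L p a q b ⊎ Through j L p a q b → Path (j ∷ L) p a q b
    join (inj₁ π)                         = widen π
    join (inj₂ (_ , π₁ , _ , loops , π₂)) = widen π₁ ++⟨ here refl ⟩ loop loops (widen π₂)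

module Trees (Σ' : RankedAlphabet) where
  open RankedAlphabet Σ'

  edge⇒chnoAux : ∀ {t j acc} {v w : Pos Σ' t} → Edge Σ' j v w → chnoAux Σ' acc w ≡ j
  edge⇒chnoAux (edge-root i) = refl
  edge⇒chnoAux (edge-in i e) = edge⇒chnoAux e

  edge⇒childIndex : ∀ {t j} {v w : Pos Σ' t} → Edge Σ' j v w →
                    Σ (Fin (rank (label Σ' v))) λ i → j ≡ suc (toℕ i)
  edge⇒childIndex (edge-root i) = i , refl
  edge⇒childIndex (edge-in i e) = edge⇒childIndex e

  root-or-child : ∀ {t} (w : Pos Σ' t) → w ≡ root Σ' ⊎ Σ ℕ λ j → Σ (Pos Σ' t) λ v → Edge Σ' j v w
  root-or-child here        = inj₁ refl
  root-or-child (child i w) with root-or-child w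
  ... | inj₁ refl        = inj₂ (_ , here , edge-root i)
  ... | inj₂ (j , v , e) = inj₂ (j , child i v , edge-in i e)

  module _ {t : Tree Σ'} {w : Pos Σ' t} where

    root⇔Anc : w ≡ root Σ' ⇔ (∀ u → Anc Σ' w u)
    root⇔Anc = mk⇔ (λ { refl _ → anc-here }) (λ w≤ → Anc-root (w≤ here))
      where
      Anc-root : ∀ {w : Pos Σ' t} → Anc Σ' w here → w ≡ here
      Anc-root anc-here = refl

    chno≡0⇔root : chno Σ' w ≡ 0 ⇔ w ≡ root Σ'
    chno≡0⇔root = mk⇔ to′ λ { refl → refl }
      where
      to′ : chno Σ' w ≡ 0 → w ≡ root Σ'
      to′ c with root-or-child w
      ... | inj₁ w≡root      = w≡root
      ... | inj₂ (_ , _ , e) with edge⇒childIndex e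
      ...   | _ , refl = ⊥-elim (0≢1+n (trans (sym c) (edge⇒chnoAux e)))

    chno≡suc⇔parent : ∀ {j} → chno Σ' w ≡ suc j ⇔ Σ (Pos Σ' t) λ v → Edge Σ' (suc j) v w
    chno≡suc⇔parent {j} = mk⇔ to′ λ { (_ , e) → edge⇒chnoAux e }
      where
      to′ : chno Σ' w ≡ suc j → Σ (Pos Σ' t) λ v → Edge Σ' (suc j) v w
      to′ c with root-or-child w
      ... | inj₁ refl        = ⊥-elim (0≢1+n c)
      ... | inj₂ (_ , v , e) = v , subst (λ j → Edge Σ' j v w) (trans (sym (edge⇒chnoAux e)) c) e

module Logic (Σ' : RankedAlphabet) (k : ℕ) where
  open RankedAlphabet Σ'
  open Trees Σ'

  Env : Tree Σ' → ℕ → Set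
  Env t n = Fin n → Pos Σ' t

  rename : ∀ {n n′} → (Fin n → Fin n′) → Formula Σ' k n → Formula Σ' k n′
  rename f (lab σ x)    = lab σ (f x)
  rename f (edg j x y)  = edg j (f x) (f y)
  rename f (leq x y)    = leq (f x) (f y)
  rename f (eq x y)     = eq (f x) (f y)
  rename f (neg φ)      = neg (rename f φ)
  rename f (and φ ψ)    = and (rename f φ) (rename f ψ)
  rename f (or φ ψ)     = or (rename f φ) (rename f ψ)
  rename f (ex φ)       = ex (rename (lift 1 f) φ)
  rename f (all φ)      = all (rename (lift 1 f) φ)
  rename f (tc φ us vs) = tc (rename (lift (k + k) f) φ) (Vec.map f us) (Vec.map f vs)

  Sat-rename : ∀ {n n′ t} (φ : Formula Σ' k n) (f : Fin n → Fin n′) {ρ : Env t n′} {ρ′ : Env t n} →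
               ρ ∘ f ≗ ρ′ → Sat Σ' t (rename f φ) ρ ⇔ Sat Σ' t φ ρ′
  Sat-rename (lab σ x)    f h = cong-⇔ (λ u → label Σ' u ≡ σ) (h x)
  Sat-rename (edg j x y)  f h = cong₂-⇔ (Edge Σ' j) (h x) (h y)
  Sat-rename (leq x y)    f h = cong₂-⇔ (Anc Σ') (h x) (h y)
  Sat-rename (eq x y)     f h = cong₂-⇔ _≡_ (h x) (h y)
  Sat-rename (neg φ)      f h = ¬-cong-⇔ (Sat-rename φ f h)
  Sat-rename (and φ ψ)    f h = Sat-rename φ f h ×-⇔ Sat-rename ψ f h
  Sat-rename (or φ ψ)     f h = Sat-rename φ f h ⊎-⇔ Sat-rename ψ f h
  Sat-rename (ex φ)       f h = Σ-cong-⇔ λ u → Sat-rename φ (lift 1 f) (∷-lift u h)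
  Sat-rename (all φ)      f h = Π-cong-⇔ λ u → Sat-rename φ (lift 1 f) (∷-lift u h)
  Sat-rename (tc φ us vs) f {ρ} {ρ′} h =
    Star-cong-⇔ (λ _ _ → Sat-rename φ (lift (k + k) f) (++-lift (k + k) _ h)) (map-map us) (map-map vs)
    where
    map-map : ∀ (us : Vec _ k) → Vec.map ρ (Vec.map f us) ≡ Vec.map ρ′ us
    map-map us = trans (sym (map-∘ ρ f us)) (map-cong h us)

  Sat-cong : ∀ {n t} (φ : Formula Σ' k n) {ρ ρ′ : Env t n} → ρ ≗ ρ′ → Sat Σ' t φ ρ ⇔ Sat Σ' t φ ρ′
  Sat-cong φ h = ⇔-trans (⇔-sym (Sat-rename φ id λ _ → refl)) (Sat-rename φ id h)

  exs : ∀ r {n} → Formula Σ' k (r + n) → Formula Σ' k n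
  exs zero    φ = φ
  exs (suc r) φ = exs r (ex φ)

  Sat-exs : ∀ r {n t} (φ : Formula Σ' k (r + n)) {ρ : Env t n} →
            Sat Σ' t (exs r φ) ρ ⇔ Σ (Vec (Pos Σ' t) r) λ c → Sat Σ' t φ (lookup c VF.++ ρ)
  Sat-exs zero    φ = mk⇔ (λ s → [] , s) λ { ([] , s) → s }
  Sat-exs (suc r) φ {ρ = ρ} = ⇔-trans (Sat-exs r (ex φ)) (mk⇔
    (λ { (c , u , s) → u ∷ c , to (Sat-cong φ (∷-++ u c)) s })
    (λ { (u ∷ c , s) → c , u , from (Sat-cong φ (∷-++ u c)) s }))
    where
    ∷-++ : ∀ u (c : Vec _ r) → u VF.∷ (lookup c VF.++ ρ) ≗ lookup (u ∷ c) VF.++ ρ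
    ∷-++ u c zero    = refl
    ∷-++ u c (suc i) = sym (++-suc (lookup (u ∷ c)) ρ i)

  Pred : ℕ → Set₁
  Pred n = (t : Tree Σ') → Env t n → Set

  record Definable {n} (P : Pred n) : Set where
    field
      formula : Formula Σ' k n
      sat⇔    : ∀ t ρ → Sat Σ' t formula ρ ⇔ P t ρ

  open Definable

  module _ {n : ℕ} where

    Sat-definable : (φ : Formula Σ' k n) → Definable (λ t → Sat Σ' t φ)
    Sat-definable φ = record { formula = φ ; sat⇔ = λ _ _ → ⇔-id _ }

    Definable-resp : {P Q : Pred n} → Definable P → (∀ t ρ → P t ρ ⇔ Q t ρ) → Definable Q
    Definable-resp dP P⇔Q = record
      { formula = formula dP ; sat⇔ = λ t ρ → ⇔-trans (sat⇔ dP t ρ) (P⇔Q t ρ) }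

    ¬-definable : {P : Pred n} → Definable P → Definable (λ t ρ → ¬ P t ρ)
    ¬-definable dP = record { formula = neg (formula dP) ; sat⇔ = λ t ρ → ¬-cong-⇔ (sat⇔ dP t ρ) }

    ×-definable : {P Q : Pred n} → Definable P → Definable Q → Definable (λ t ρ → P t ρ × Q t ρ)
    ×-definable dP dQ = record
      { formula = and (formula dP) (formula dQ) ; sat⇔ = λ t ρ → sat⇔ dP t ρ ×-⇔ sat⇔ dQ t ρ }

    ⊎-definable : {P Q : Pred n} → Definable P → Definable Q → Definable (λ t ρ → P t ρ ⊎ Q t ρ)
    ⊎-definable dP dQ = record
      { formula = or (formula dP) (formula dQ) ; sat⇔ = λ t ρ → sat⇔ dP t ρ ⊎-⇔ sat⇔ dQ t ρ }

    ∃-definable : {P : Pred (suc n)} → Definable P →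
                  Definable (λ t ρ → Σ (Pos Σ' t) λ u → P t (u VF.∷ ρ))
    ∃-definable dP = record
      { formula = ex (formula dP) ; sat⇔ = λ t ρ → Σ-cong-⇔ λ u → sat⇔ dP t (u VF.∷ ρ) }

    Π-definable : {P : Pred (suc n)} → Definable P →
                  Definable (λ t ρ → (u : Pos Σ' t) → P t (u VF.∷ ρ))
    Π-definable dP = record
      { formula = all (formula dP) ; sat⇔ = λ t ρ → Π-cong-⇔ λ u → sat⇔ dP t (u VF.∷ ρ) }

    -- There is no formula for truth; ∀u. u = u serves.
    Dec-definable : {A : Set} → Dec A → Definable {n} (λ _ _ → A)
    Dec-definable (yes a) = record
      { formula = all (eq zero zero) ; sat⇔ = λ _ _ → mk⇔ (λ _ → a) (λ _ _ → refl) }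
    Dec-definable (no ¬a) = record
      { formula = neg (all (eq zero zero))
      ; sat⇔ = λ _ _ → mk⇔ (λ ¬⊤ → ⊥-elim (¬⊤ λ _ → refl)) (λ a → ⊥-elim (¬a a)) }

    ∃∈-definable : {A : Set} (xs : List A) {P : A → Pred n} → (∀ x → Definable (P x)) →
                   Definable (λ t ρ → Σ A λ x → x ∈ xs × P x t ρ)
    ∃∈-definable []       dP =
      Definable-resp (Dec-definable {A = ⊥} (no λ ())) λ _ _ → mk⇔ (λ ()) λ { (_ , () , _) }
    ∃∈-definable (x ∷ xs) dP = Definable-resp (⊎-definable (dP x) (∃∈-definable xs dP)) λ _ _ → mk⇔
      [ (λ p → x , here refl , p) , (λ { (y , y∈ , p) → y , there y∈ , p }) ]′
      (λ { (_ , here refl , p) → inj₁ p ; (y , there y∈ , p) → inj₂ (y , y∈ , p) })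

    ∀∈-definable : {A : Set} (xs : List A) {P : A → Pred n} → (∀ x → Definable (P x)) →
                   Definable (λ t ρ → ∀ x → x ∈ xs → P x t ρ)
    ∀∈-definable []       dP = Definable-resp (Dec-definable (yes tt)) λ _ _ → mk⇔ (λ _ _ ()) (λ _ → tt)
    ∀∈-definable (x ∷ xs) dP = Definable-resp (×-definable (dP x) (∀∈-definable xs dP)) λ _ _ → mk⇔
      (λ { (p , ps) _ (here refl) → p ; (p , ps) y (there y∈) → ps y y∈ })
      (λ ps → ps x (here refl) , λ y y∈ → ps y (there y∈))

    ∃-Fin-definable : ∀ {N} {P : Fin N → Pred n} → (∀ i → Definable (P i)) →
                      Definable (λ t ρ → Σ (Fin N) λ i → P i t ρ)
    ∃-Fin-definable {N} dP = Definable-resp (∃∈-definable (List.allFin N) dP) λ _ _ → mk⇔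
      (λ { (i , _ , p) → i , p }) (λ { (i , p) → i , ∈-allFin i , p })

    ≡ᵛ-definable : ∀ {r} (us vs : Vec (Fin n) r) → Definable (λ t ρ → Vec.map ρ us ≡ Vec.map ρ vs)
    ≡ᵛ-definable []       []       =
      Definable-resp (Dec-definable (yes tt)) λ _ _ → mk⇔ (λ _ → refl) (λ _ → tt)
    ≡ᵛ-definable (u ∷ us) (v ∷ vs) =
      Definable-resp (×-definable (Sat-definable (eq u v)) (≡ᵛ-definable us vs)) λ _ _ →
        mk⇔ (λ { (p , ps) → cong₂ _∷_ p ps }) ∷-injective

  module _ {n n′ : ℕ} {P : Pred n} (dP : Definable P) (g : Fin n → Fin n′) where

    sat-instance : ∀ {t} {ρ : Env t n′} {ρ′ : Env t n} → ρ ∘ g ≗ ρ′ →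
                   Sat Σ' t (rename g (formula dP)) ρ ⇔ P t ρ′
    sat-instance {t} {ρ′ = ρ′} h = ⇔-trans (Sat-rename (formula dP) g h) (sat⇔ dP t ρ′)

    rename-definable : Definable (λ t ρ → P t (ρ ∘ g))
    rename-definable = record { formula = rename g (formula dP) ; sat⇔ = λ _ _ → sat-instance λ _ → refl }

  root-definable : ∀ {n} (x : Fin n) → Definable (λ t ρ → ρ x ≡ root Σ')
  root-definable x =
    Definable-resp (Π-definable (Sat-definable (leq (suc x) zero))) λ _ _ → ⇔-sym root⇔Anc

  chno-definable : ∀ {n} (x : Fin n) j → Definable (λ t ρ → chno Σ' (ρ x) ≡ j)
  chno-definable x zero    = Definable-resp (root-definable x) λ _ _ → ⇔-sym chno≡0⇔root
  chno-definable x (suc j) =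
    Definable-resp (∃-definable (Sat-definable (edg (suc j) zero (suc x)))) λ _ _ → ⇔-sym chno≡suc⇔parent

  -- Child numbers below a node are bounded by the rank of its label, so the existential over j
  -- is a finite disjunction.
  parent-definable : ∀ {n} (x y : Fin n) → Definable (λ t ρ → Σ ℕ λ j → Edge Σ' j (ρ x) (ρ y))
  parent-definable x y = Definable-resp
    (∃-Fin-definable λ σ → ∃-Fin-definable {N = rank σ} λ i →
      ×-definable (Sat-definable (lab σ x)) (Sat-definable (edg (suc (toℕ i)) x y)))
    λ _ _ → mk⇔ (λ { (_ , _ , _ , e) → _ , e }) λ { (_ , e) → child-index e }
    where
    child-index : ∀ {t j} {v w : Pos Σ' t} → Edge Σ' j v w →
                  Σ (Fin size) λ σ → Σ (Fin (rank σ)) λ i → label Σ' v ≡ σ × Edge Σ' (suc (toℕ i)) v w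
    child-index e with edge⇒childIndex e
    ... | i , refl = _ , i , refl , e

  Tuple : Tree Σ' → Set
  Tuple t = Vec (Pos Σ' t) k

  RelPred : ℕ → Set₁
  RelPred m = (t : Tree Σ') → Env t m → Tuple t → Tuple t → Set

  ⟨_∣_∣_⟩ : ∀ {m} {A : Set} → (Fin k → A) → (Fin k → A) → (Fin m → A) → Fin (k + k + m) → A
  ⟨ f ∣ g ∣ h ⟩ = (f VF.++ g) VF.++ h

  module _ {m : ℕ} where

    var₁ var₂ : Fin k → Fin (k + k + m)
    var₁ i = (i ↑ˡ k) ↑ˡ m
    var₂ i = (k ↑ʳ i) ↑ˡ m

    par : Fin m → Fin (k + k + m)
    par l = (k + k) ↑ʳ l

  module _ {m} {A : Set} {f g : Fin k → A} {h : Fin m → A} where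

    ⟨⟩-var₁ : ∀ i → ⟨ f ∣ g ∣ h ⟩ (var₁ i) ≡ f i
    ⟨⟩-var₁ i = trans (lookup-++ˡ (f VF.++ g) h (i ↑ˡ k)) (lookup-++ˡ f g i)

    ⟨⟩-var₂ : ∀ i → ⟨ f ∣ g ∣ h ⟩ (var₂ i) ≡ g i
    ⟨⟩-var₂ i = trans (lookup-++ˡ (f VF.++ g) h (k ↑ʳ i)) (lookup-++ʳ f g i)

    ⟨⟩-par : ∀ l → ⟨ f ∣ g ∣ h ⟩ (par l) ≡ h l
    ⟨⟩-par = lookup-++ʳ (f VF.++ g) h

    ∘-⟨⟩ : {B : Set} (ρ : A → B) {f′ g′ : Fin k → B} {h′ : Fin m → B} →
           ρ ∘ f ≗ f′ → ρ ∘ g ≗ g′ → ρ ∘ h ≗ h′ → ρ ∘ ⟨ f ∣ g ∣ h ⟩ ≗ ⟨ f′ ∣ g′ ∣ h′ ⟩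
    ∘-⟨⟩ ρ p q r i = trans ([,]-∘ ρ (splitAt (k + k) i))
      (++-cong _ _ (λ j → trans ([,]-∘ ρ (splitAt k j)) (++-cong _ _ p q j)) r i)

  record RelDefinable {m} (R : RelPred m) : Set where
    field
      formula : Formula Σ' k (k + k + m)
      sat⇔    : ∀ t ζ a b → Sat Σ' t formula ⟨ lookup a ∣ lookup b ∣ ζ ⟩ ⇔ R t ζ a b

  open RelDefinable

  module _ {m n : ℕ} {R : RelPred m} (dR : RelDefinable R) (g : Fin (k + k + m) → Fin n) where

    sat-relInstance : ∀ {t ζ a b} {ρ : Env t n} → ρ ∘ g ≗ ⟨ lookup a ∣ lookup b ∣ ζ ⟩ →
                      Sat Σ' t (rename g (formula dR)) ρ ⇔ R t ζ a b
    sat-relInstance {t} {ζ} {a} {b} h = ⇔-trans (Sat-rename (formula dR) g h) (sat⇔ dR t ζ a b)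

  module _ {m : ℕ} where

    relDefinable : {P : Pred (k + k + m)} {R : RelPred m} → Definable P →
                   (∀ t ζ a b → P t ⟨ lookup a ∣ lookup b ∣ ζ ⟩ ⇔ R t ζ a b) → RelDefinable R
    relDefinable dP P⇔R = record
      { formula = formula dP ; sat⇔ = λ t ζ a b → ⇔-trans (sat⇔ dP t _) (P⇔R t ζ a b) }

    RelDefinable-resp : {R S : RelPred m} → RelDefinable R → (∀ t ζ a b → R t ζ a b ⇔ S t ζ a b) →
                        RelDefinable S
    RelDefinable-resp dR R⇔S = record
      { formula = formula dR ; sat⇔ = λ t ζ a b → ⇔-trans (sat⇔ dR t ζ a b) (R⇔S t ζ a b) }

    ⊎-relDefinable : {R S : RelPred m} → RelDefinable R → RelDefinable S →
                     RelDefinable (λ t ζ a b → R t ζ a b ⊎ S t ζ a b)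
    ⊎-relDefinable dR dS = record
      { formula = or (formula dR) (formula dS)
      ; sat⇔ = λ t ζ a b → sat⇔ dR t ζ a b ⊎-⇔ sat⇔ dS t ζ a b }

    ×-relDefinable : {R S : RelPred m} → RelDefinable R → RelDefinable S →
                     RelDefinable (λ t ζ a b → R t ζ a b × S t ζ a b)
    ×-relDefinable dR dS = record
      { formula = and (formula dR) (formula dS)
      ; sat⇔ = λ t ζ a b → sat⇔ dR t ζ a b ×-⇔ sat⇔ dS t ζ a b }

    Dec-relDefinable : {A : Set} → Dec A → RelDefinable {m} (λ _ _ _ _ → A)
    Dec-relDefinable A? = relDefinable (Dec-definable A?) λ _ _ _ _ → ⇔-id _

    ∃∈-relDefinable : {A : Set} (xs : List A) {R : A → RelPred m} → (∀ x → RelDefinable (R x)) →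
                      RelDefinable (λ t ζ a b → Σ A λ x → x ∈ xs × R x t ζ a b)
    ∃∈-relDefinable []       dR = RelDefinable-resp (Dec-relDefinable {A = ⊥} (no λ ()))
      λ _ _ _ _ → mk⇔ (λ ()) λ { (_ , () , _) }
    ∃∈-relDefinable (x ∷ xs) dR =
      RelDefinable-resp (⊎-relDefinable (dR x) (∃∈-relDefinable xs dR)) λ _ _ _ _ → mk⇔
        [ (λ r → x , here refl , r) , (λ { (y , y∈ , r) → y , there y∈ , r }) ]′
        (λ { (_ , here refl , r) → inj₁ r ; (y , there y∈ , r) → inj₂ (y , y∈ , r) })

    ≡-relDefinable : RelDefinable {m} (λ _ _ a b → a ≡ b)
    ≡-relDefinable = relDefinable (≡ᵛ-definable (tabulate var₁) (tabulate var₂))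
      λ _ _ _ _ → cong₂-⇔ _≡_ (map-tabulate-≗ _ ⟨⟩-var₁) (map-tabulate-≗ _ ⟨⟩-var₂)

    ⨾-relDefinable : {R S : RelPred m} → RelDefinable R → RelDefinable S →
                     RelDefinable (λ t ζ a b → Σ (Tuple t) λ c → R t ζ a c × S t ζ c b)
    ⨾-relDefinable dR dS = record
      { formula = exs k (and (rename first (formula dR)) (rename second (formula dS)))
      ; sat⇔ = λ t ζ a b → ⇔-trans (Sat-exs k _) (Σ-cong-⇔ λ c →
          sat-relInstance dR first (first-ok ζ a b c) ×-⇔ sat-relInstance dS second (second-ok ζ a b c)) }
      where
      new : Fin k → Fin (k + (k + k + m))
      new i = i ↑ˡ (k + k + m)

      old : Fin (k + k + m) → Fin (k + (k + k + m))
      old = k ↑ʳ_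

      first second : Fin (k + k + m) → Fin (k + (k + k + m))
      first  = ⟨ old ∘ var₁ ∣ new ∣ old ∘ par ⟩
      second = ⟨ new ∣ old ∘ var₂ ∣ old ∘ par ⟩

      module _ {t} (ζ : Env t m) (a b c : Tuple t) where

        ρ : Env t (k + (k + k + m))
        ρ = lookup c VF.++ ⟨ lookup a ∣ lookup b ∣ ζ ⟩

        new-c : ρ ∘ new ≗ lookup c
        new-c = lookup-++ˡ (lookup c) _

        old-var₁ : ρ ∘ (old ∘ var₁) ≗ lookup a
        old-var₁ i = trans (lookup-++ʳ (lookup c) _ (var₁ i)) (⟨⟩-var₁ i)

        old-var₂ : ρ ∘ (old ∘ var₂) ≗ lookup b
        old-var₂ i = trans (lookup-++ʳ (lookup c) _ (var₂ i)) (⟨⟩-var₂ i)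

        old-par : ρ ∘ (old ∘ par) ≗ ζ
        old-par l = trans (lookup-++ʳ (lookup c) _ (par l)) (⟨⟩-par l)

        first-ok : ρ ∘ first ≗ ⟨ lookup a ∣ lookup c ∣ ζ ⟩
        first-ok = ∘-⟨⟩ {f = old ∘ var₁} {new} {old ∘ par} ρ old-var₁ new-c old-par

        second-ok : ρ ∘ second ≗ ⟨ lookup c ∣ lookup b ∣ ζ ⟩
        second-ok = ∘-⟨⟩ {f = new} {old ∘ var₂} {old ∘ par} ρ new-c old-var₂ old-par

    Star-relDefinable : {R : RelPred m} → RelDefinable R → RelDefinable (λ t ζ → Star (R t ζ))
    Star-relDefinable dR = record
      { formula = tc (rename (lift (k + k) par) (formula dR)) (tabulate var₁) (tabulate var₂)
      ; sat⇔ = λ t ζ a b → Star-cong-⇔ (λ _ _ → sat-relInstance dR _ (++-lift (k + k) _ ⟨⟩-par))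
                                        (map-tabulate-≗ _ ⟨⟩-var₁) (map-tabulate-≗ _ ⟨⟩-var₂) }

  module _ {N m : ℕ} (M : Fin N → Fin N → RelPred m) (dM : ∀ p q → RelDefinable (M p q)) where

    private
      module K {t} (ζ : Env t m) = Kleene (λ p q → M p q t ζ)

    Path-relDefinable : ∀ L p q → RelDefinable (λ t ζ a b → K.Path ζ L p a q b)
    Path-relDefinable []      p q = RelDefinable-resp (dM p q) λ _ ζ _ _ → ⇔-sym (K.Path-[] ζ)
    Path-relDefinable (j ∷ L) p q = RelDefinable-resp
      (⊎-relDefinable (Path-relDefinable L p q)
        (⨾-relDefinable (Path-relDefinable L p j)
          (⨾-relDefinable (Star-relDefinable (Path-relDefinable L j j)) (Path-relDefinable L j q))))
      λ _ ζ _ _ → ⇔-sym (K.Path-∷ ζ)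

    Star-Transition-relDefinable : ∀ p q → RelDefinable (λ t ζ a b → Star (K.Transition ζ) (p , a) (q , b))
    Star-Transition-relDefinable p q = RelDefinable-resp
      (⊎-relDefinable (×-relDefinable (Dec-relDefinable (p Fin.≟ q)) ≡-relDefinable)
                      (Path-relDefinable (List.allFin N) p q))
      λ _ ζ _ _ → ⇔-sym (K.Star⇔Path ζ ∈-allFin)

module Automata (Σ' : RankedAlphabet) (k : ℕ) (𝒜 : Automaton Σ' k) where
  open RankedAlphabet Σ'
  open Automaton 𝒜
  open Logic Σ' k
  open Definable
  open RelDefinable
  open import Data.List.Membership.DecPropositional (Fin._≟_ {nX}) using (_∉?_)

  State : Set
  State = Fin nQ

  Instruction : Set
  Instruction = State × Instr Σ' k nX × State

  -- Views of an instruction as a drop or a retrieve; Call below can then be defined, and shown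
  -- definable, by a single case split with a catch-all.
  dropOf : (χ : Instr Σ' k nX) → Maybe (Σ (Fin k) λ i → Σ (Fin nX) λ x → χ ≡ drop i x)
  dropOf (drop i x) = just (i , x , refl)
  dropOf _          = nothing

  retrieveOf : (χ : Instr Σ' k nX) → Maybe (Σ (Fin nX) λ x → χ ≡ retrieve x)
  retrieveOf (retrieve x) = just (x , refl)
  retrieveOf _            = nothing

  names : ∀ {t} → Stack Σ' nX t → List (Fin nX)
  names = List.map proj₁

  module _ {t : Tree Σ'} where

    LocalStep : Instruction → Stack Σ' nX t → State → State → Tuple t → Tuple t → Set
    LocalStep (p′ , χ , q′) α p q a b = p′ ≡ p × q′ ≡ q × Apply Σ' χ a α b α

    Local : Stack Σ' nX t → State → State → Tuple t → Tuple t → Set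
    Local α p q a b = Σ Instruction λ ins → ins ∈ instrs × LocalStep ins α p q a b

    -- Run n α: runs that never pop below α and keep at most n pebbles on top of it.
    Macro : ℕ → Stack Σ' nX t → State → State → Tuple t → Tuple t → Set
    Call  : ℕ → Stack Σ' nX t → Instruction → Instruction → State → State → Tuple t → Tuple t → Set
    Run   : ℕ → Stack Σ' nX t → State → State → Tuple t → Tuple t → Set

    Macro zero    α p q a b = Local α p q a b
    Macro (suc n) α p q a b = Local α p q a b ⊎
      Σ Instruction λ ins₁ → ins₁ ∈ instrs × Σ Instruction λ ins₂ → ins₂ ∈ instrs ×
        Call n α ins₁ ins₂ p q a b

    Call n α (p₁ , χ₁ , p′) (q′ , χ₂ , q₂) p q a b with dropOf χ₁ | retrieveOf χ₂
    ... | just (i , x , _) | just (y , _) =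
      p₁ ≡ p × q₂ ≡ q × y ≡ x × x ∉ names α × Run n ((x , lookup a i) ∷ α) p′ q′ a b
    ... | _ | _ = ⊥

    Run n α p q a b = Star (Kleene.Transition (λ p q → Macro n α p q)) (p , a) (q , b)

    _⟶_ : Config Σ' 𝒜 t → Config Σ' 𝒜 t → Set
    _⟶_ = Step Σ' 𝒜 t

    _⟶*_ : Config Σ' 𝒜 t → Config Σ' 𝒜 t → Set
    _⟶*_ = Star _⟶_

    data Effect : Instr Σ' k nX → Tuple t → Stack Σ' nX t → Tuple t → Stack Σ' nX t → Set where
      keep : ∀ {χ u α u′} → Apply Σ' χ u α u′ α → Effect χ u α u′ α
      push : ∀ {i x u α} → x ∉ names α → Effect (drop i x) u α u ((x , lookup u i) ∷ α)
      pop  : ∀ {x w u α} → Effect (retrieve x) u ((x , w) ∷ α) u α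

    effect : ∀ {χ u α u′ α′} → Apply Σ' χ u α u′ α′ → Effect χ u α u′ α′
    effect ap@(ap-up _)    = keep ap
    effect ap@(ap-down _)  = keep ap
    effect (ap-drop x∉)    = push x∉
    effect ap-retr         = pop
    effect ap@(ap-lab _)   = keep ap
    effect ap@(ap-peb _)   = keep ap
    effect ap@(ap-chno _)  = keep ap
    effect ap@(ap-nlab _)  = keep ap
    effect ap@(ap-npeb _)  = keep ap
    effect ap@(ap-nchno _) = keep ap

    Local⇒Macro : ∀ n {α p q a b} → Local α p q a b → Macro n α p q a b
    Local⇒Macro zero    = id
    Local⇒Macro (suc n) = inj₁

    Local⇒⟶ : ∀ {α p q a b} → Local α p q a b → [ p , a , α ] ⟶ [ q , b , α ]
    Local⇒⟶ (_ , mem , refl , refl , ap) = step mem ap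

    Run⇒⟶*   : ∀ n {α p q a b} → Run n α p q a b → [ p , a , α ] ⟶* [ q , b , α ]
    Macro⇒⟶* : ∀ n {α p q a b} → Macro n α p q a b → [ p , a , α ] ⟶* [ q , b , α ]
    Call⇒⟶*  : ∀ n {α p q a b ins₁ ins₂} → ins₁ ∈ instrs → ins₂ ∈ instrs →
               Call n α ins₁ ins₂ p q a b → [ p , a , α ] ⟶* [ q , b , α ]

    Run⇒⟶* n ε        = ε
    Run⇒⟶* n (m ◅ ms) = Macro⇒⟶* n m ◅◅ Run⇒⟶* n ms

    Macro⇒⟶* zero    l        = Star.return (Local⇒⟶ l)
    Macro⇒⟶* (suc n) (inj₁ l) = Star.return (Local⇒⟶ l)
    Macro⇒⟶* (suc n) (inj₂ (_ , mem₁ , _ , mem₂ , call)) = Call⇒⟶* n mem₁ mem₂ call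

    Call⇒⟶* n {ins₁ = _ , χ₁ , _} {_ , χ₂ , _} mem₁ mem₂ call with dropOf χ₁ | retrieveOf χ₂ | call
    ... | just (i , x , refl) | just (_ , refl) | refl , refl , refl , x∉ , run =
      step mem₁ (ap-drop x∉) ◅ Run⇒⟶* n run ◅◅ Star.return (step mem₂ ap-retr)

    -- Prefix n α p a C: C is reached from [ p , a , α ] without popping α; in a nested prefix
    -- the drop that entered the inner stack has not been matched by a retrieve yet.
    data Prefix : ℕ → Stack Σ' nX t → State → Tuple t → Config Σ' 𝒜 t → Set where
      flat   : ∀ {n α p a q b} → Run n α p q a b → Prefix n α p a [ q , b , α ]
      nested : ∀ {n α p a r c i x r′ C} → Run (suc n) α p r a c → (r , drop i x , r′) ∈ instrs →
               x ∉ names α → Prefix n ((x , lookup c i) ∷ α) r′ c C → Prefix (suc n) α p a C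

    data Pops (n : ℕ) : Stack Σ' nX t → State → Tuple t → Config Σ' 𝒜 t → Set where
      pops : ∀ {x w α p a q b q′} → Run n ((x , w) ∷ α) p q a b → (q , retrieve x , q′) ∈ instrs →
             Pops n ((x , w) ∷ α) p a [ q′ , b , α ]

    Fits : ℕ → Stack Σ' nX t → Set
    Fits n α = length α + n ≡ nX × Unique (names α)

    Fits-push : ∀ {n α x w} → Fits (suc n) α → x ∉ names α → Fits n ((x , w) ∷ α)
    Fits-push {n} {α} (len , unique) x∉ =
      trans (sym (+-suc (length α) n)) len , ¬Any⇒All¬ _ x∉ ∷ unique

    -- Pigeonhole: the nX pebbles on α are distinct, so none is left to drop.
    Fits-full : ∀ {α x} → Fits 0 α → x ∉ names α → ⊥
    Fits-full {α} (len , unique) x∉ =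
      1+n≰n (subst (λ l → suc l ≤ nX) length-names (Unique⇒length≤ (¬Any⇒All¬ _ x∉ ∷ unique)))
      where
      length-names : length (names α) ≡ nX
      length-names = trans (length-map proj₁ α) (trans (sym (+-identityʳ (length α))) len)

    enter : ∀ {n α p a r c i x r′} → Fits n α → Run n α p r a c → (r , drop i x , r′) ∈ instrs →
            x ∉ names α → Prefix n α p a [ r′ , c , (x , lookup c i) ∷ α ]
    enter {zero}  fits _   _   x∉ = ⊥-elim (Fits-full fits x∉)
    enter {suc n} fits run mem x∉ = nested run mem x∉ (flat ε)

    extend : ∀ {n α p a C C′} → Fits n α → Prefix n α p a C → C ⟶ C′ →
             Prefix n α p a C′ ⊎ Pops n α p a C′
    extend {n} fits (flat run) (step mem ap) with effect ap
    ... | keep ap′ = inj₁ (flat (run ◅◅ Star.return (Local⇒Macro n (_ , mem , refl , refl , ap′))))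
    ... | push x∉  = inj₁ (enter fits run mem x∉)
    ... | pop      = inj₂ (pops run mem)
    extend fits (nested {c = c} {i} run mem x∉ inner) s
      with extend (Fits-push {w = lookup c i} fits x∉) inner s
    ... | inj₁ inner′           = inj₁ (nested run mem x∉ inner′)
    ... | inj₂ (pops run′ mem′) =
      inj₁ (flat (run ◅◅ Star.return (inj₂ (_ , mem , _ , mem′ , refl , refl , refl , x∉ , run′))))

    Prefix-⟶* : ∀ {p a C C′} → Prefix nX [] p a C → C ⟶* C′ → Prefix nX [] p a C′
    Prefix-⟶* P ε = P
    Prefix-⟶* P (s ◅ ss) with extend (refl , []) P s
    ... | inj₁ P′ = Prefix-⟶* P′ ss

    Prefix-length : ∀ {n α p a C} → Prefix n α p a C → length α ≤ length (Config.stack C)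
    Prefix-length (flat _)             = ≤-refl
    Prefix-length (nested _ _ _ inner) = <⇒≤ (Prefix-length inner)

    Prefix⇒Run : ∀ {n p a q b} → Prefix n [] p a [ q , b , [] ] → Run n [] p q a b
    Prefix⇒Run (flat run) = run
    Prefix⇒Run (nested _ _ _ inner) with Prefix-length inner
    ... | ()

    ⟶*⇔Run : ∀ {p a q b} → [ p , a , [] ] ⟶* [ q , b , [] ] ⇔ Run nX [] p q a b
    ⟶*⇔Run = mk⇔ (Prefix⇒Run ∘ Prefix-⟶* (flat ε)) (Run⇒⟶* nX)

    -- On the empty stack every drop is enabled and no retrieve is.
    Enabled : Instruction → State → Tuple t → Set
    Enabled (p′ , χ , _) p a = p′ ≡ p × (T (is-just (dropOf χ)) ⊎ Σ (Tuple t) λ b → Apply Σ' χ a [] b [])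

    Halting⇔ : ∀ {p a} → Halting Σ' 𝒜 t [ p , a , [] ] ⇔ (∀ ins → ins ∈ instrs → ¬ Enabled ins p a)
    Halting⇔ {p} {a} = mk⇔ to′ from′
      where
      to′ : Halting Σ' 𝒜 t [ p , a , [] ] → ∀ ins → ins ∈ instrs → ¬ Enabled ins p a
      to′ H _           mem (refl , inj₂ (_ , ap)) = H _ (step mem ap)
      to′ H (_ , χ , _) mem (refl , inj₁ isDrop) with dropOf χ | isDrop
      ... | just (_ , _ , refl) | _ = H _ (step mem (ap-drop λ ()))

      from′ : (∀ ins → ins ∈ instrs → ¬ Enabled ins p a) → Halting Σ' 𝒜 t [ p , a , [] ]
      from′ f _ (step mem ap) with effect ap
      ... | keep ap′ = f _ mem (refl , inj₂ (_ , ap′))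
      ... | push _   = f _ mem (refl , inj₁ tt)

  module _ {t : Tree Σ'} {u u′ : Tuple t} {α : Stack Σ' nX t} where

    drop-changes-stack : ∀ {i x} → ¬ Apply Σ' (drop i x) u α u′ α
    drop-changes-stack ()

    retrieve-changes-stack : ∀ {x} → ¬ Apply Σ' (retrieve x) u α u′ α
    retrieve-changes-stack ()

  -- In the formulas below the pebble names s are fixed and the positions ζ are parameters.
  stack : ∀ {t m} → (Fin m → Fin nX) → Env t m → Stack Σ' nX t
  stack {m = zero}  s ζ = []
  stack {m = suc m} s ζ = (s zero , ζ zero) ∷ stack (s ∘ suc) (ζ ∘ suc)

  module _ {t : Tree Σ'} where

    names-stack : ∀ {m} (s : Fin m → Fin nX) (ζ : Env t m) → names (stack s ζ) ≡ List.tabulate s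
    names-stack {zero}  s ζ = refl
    names-stack {suc m} s ζ = cong (s zero ∷_) (names-stack (s ∘ suc) (ζ ∘ suc))

    ∈-stack : ∀ {m} {s : Fin m → Fin nX} {ζ : Env t m} {x w} →
              (x , w) ∈ stack s ζ ⇔ Σ (Fin m) λ l → s l ≡ x × ζ l ≡ w
    ∈-stack {zero}  = mk⇔ (λ ()) λ { (() , _) }
    ∈-stack {suc m} = mk⇔
      (λ { (here refl) → zero , refl , refl
         ; (there x∈) → let l , p = to ∈-stack x∈ in suc l , p })
      (λ { (zero , refl , refl) → here refl
         ; (suc l , p) → there (from ∈-stack (l , p)) })

  pebble-definable : ∀ {m} (s : Fin m → Fin nX) (x : Fin nX) →
                     Definable (λ t ρ → (x , ρ zero) ∈ stack s (ρ ∘ suc))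
  pebble-definable s x = Definable-resp
    (∃-Fin-definable λ l → ×-definable (Dec-definable (s l Fin.≟ x)) (Sat-definable (eq (suc l) zero)))
    λ _ _ → ⇔-sym ∈-stack

  module _ {m : ℕ} where

    test-relDefinable : {P : (t : Tree Σ') → Env t m → Pos Σ' t → Set} (i : Fin k) →
                        Definable (λ t ρ → P t (ρ ∘ suc) (ρ zero)) →
                        RelDefinable (λ t ζ a b → P t ζ (lookup a i) × a ≡ b)
    test-relDefinable {P} i dP = ×-relDefinable at-head ≡-relDefinable
      where
      at-head : RelDefinable (λ t ζ a b → P t ζ (lookup a i))
      at-head = record
        { formula = rename (var₁ i VF.∷ par) (formula dP)
        ; sat⇔ = λ _ ζ a _ → sat-instance dP _ {ρ′ = lookup a i VF.∷ ζ}
                   λ { zero → ⟨⟩-var₁ i ; (suc l) → ⟨⟩-par l } }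

    move-relDefinable : {E : (t : Tree Σ') → Pos Σ' t → Pos Σ' t → Set} (i : Fin k) →
                        Definable (λ t ρ → E t (ρ zero) (ρ (suc zero))) →
                        RelDefinable {m} λ t ζ a b →
                          Σ (Pos Σ' t) λ v → E t (lookup a i) v × b ≡ a Vec.[ i ]≔ v
    move-relDefinable {E} i dE = relDefinable
      (∃-definable (×-definable
        (rename-definable dE (suc (var₁ i) VF.∷ zero VF.∷ VF.[]))
        (≡ᵛ-definable (Vec.map suc (tabulate var₂)) (Vec.map suc (tabulate var₁) Vec.[ i ]≔ zero))))
      λ t ζ a b → Σ-cong-⇔ λ v → cong-⇔ (λ w → E t w v) (⟨⟩-var₁ i) ×-⇔
        cong₂-⇔ _≡_ (map-suc-tabulate v ⟨⟩-var₂)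
                    (trans (map-[]≔ (v VF.∷ _) _ i) (cong (Vec._[ i ]≔ v) (map-suc-tabulate v ⟨⟩-var₁)))
      where
      map-suc-tabulate : ∀ {t} {ρ : Env t (k + k + m)} {f : Fin k → Fin (k + k + m)} {c : Tuple t} v →
                         ρ ∘ f ≗ lookup c → Vec.map (v VF.∷ ρ) (Vec.map suc (tabulate f)) ≡ c
      map-suc-tabulate v h = trans (sym (map-∘ (v VF.∷ _) suc _)) (map-tabulate-≗ _ h)

    Apply-relDefinable : (s : Fin m → Fin nX) (χ : Instr Σ' k nX) →
                         RelDefinable (λ t ζ a b → Apply Σ' χ a (stack s ζ) b (stack s ζ))
    Apply-relDefinable s (up i) = RelDefinable-resp
      (move-relDefinable {λ t w v → Σ ℕ λ j → Edge Σ' j v w} i (parent-definable (suc zero) zero))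
      λ _ _ _ _ → mk⇔ (λ { (_ , (_ , e) , refl) → ap-up e }) (λ { (ap-up e) → _ , (_ , e) , refl })
    Apply-relDefinable s (down i j) = RelDefinable-resp
      (move-relDefinable {λ t w v → Edge Σ' j w v} i (Sat-definable (edg j zero (suc zero))))
      λ _ _ _ _ → mk⇔ (λ { (_ , e , refl) → ap-down e }) (λ { (ap-down e) → _ , e , refl })
    Apply-relDefinable s (drop i x) = RelDefinable-resp (Dec-relDefinable {A = ⊥} (no λ ()))
      λ _ _ _ _ → mk⇔ (λ ()) drop-changes-stack
    Apply-relDefinable s (retrieve x) = RelDefinable-resp (Dec-relDefinable {A = ⊥} (no λ ()))
      λ _ _ _ _ → mk⇔ (λ ()) retrieve-changes-stack
    Apply-relDefinable s (labT i σ) = RelDefinable-resp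
      (test-relDefinable {λ _ _ w → label Σ' w ≡ σ} i (Sat-definable (lab σ zero)))
      λ _ _ _ _ → mk⇔ (λ { (e , refl) → ap-lab e }) (λ { (ap-lab e) → e , refl })
    Apply-relDefinable s (nlabT i σ) = RelDefinable-resp
      (test-relDefinable {λ _ _ w → ¬ label Σ' w ≡ σ} i (¬-definable (Sat-definable (lab σ zero))))
      λ _ _ _ _ → mk⇔ (λ { (e , refl) → ap-nlab e }) (λ { (ap-nlab e) → e , refl })
    Apply-relDefinable s (pebT i x) = RelDefinable-resp
      (test-relDefinable {λ _ ζ w → (x , w) ∈ stack s ζ} i (pebble-definable s x))
      λ _ _ _ _ → mk⇔ (λ { (e , refl) → ap-peb e }) (λ { (ap-peb e) → e , refl })
    Apply-relDefinable s (npebT i x) = RelDefinable-resp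
      (test-relDefinable {λ _ ζ w → ¬ (x , w) ∈ stack s ζ} i (¬-definable (pebble-definable s x)))
      λ _ _ _ _ → mk⇔ (λ { (e , refl) → ap-npeb e }) (λ { (ap-npeb e) → e , refl })
    Apply-relDefinable s (chnoT i j) = RelDefinable-resp
      (test-relDefinable {λ _ _ w → chno Σ' w ≡ j} i (chno-definable zero j))
      λ _ _ _ _ → mk⇔ (λ { (e , refl) → ap-chno e }) (λ { (ap-chno e) → e , refl })
    Apply-relDefinable s (nchnoT i j) = RelDefinable-resp
      (test-relDefinable {λ _ _ w → ¬ chno Σ' w ≡ j} i (¬-definable (chno-definable zero j)))
      λ _ _ _ _ → mk⇔ (λ { (e , refl) → ap-nchno e }) (λ { (ap-nchno e) → e , refl })

    Local-relDefinable : (s : Fin m → Fin nX) (p q : State) → RelDefinable (λ t ζ → Local (stack s ζ) p q)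
    Local-relDefinable s p q = ∃∈-relDefinable instrs λ { (p′ , χ , q′) →
      ×-relDefinable (Dec-relDefinable (p′ Fin.≟ p))
        (×-relDefinable (Dec-relDefinable (q′ Fin.≟ q)) (Apply-relDefinable s χ)) }

    headParam-relDefinable : {R : RelPred (suc m)} (i : Fin k) → RelDefinable R →
                             RelDefinable (λ t ζ a b → R t (lookup a i VF.∷ ζ) a b)
    headParam-relDefinable i dR = record
      { formula = rename g (formula dR)
      ; sat⇔ = λ _ ζ a b → sat-relInstance dR g (g-ok ζ a b) }
      where
      g : Fin (k + k + suc m) → Fin (k + k + m)
      g = ⟨ var₁ ∣ var₂ ∣ var₁ i VF.∷ par ⟩

      g-ok : ∀ {t} (ζ : Env t m) (a b : Tuple t) →
             ⟨ lookup a ∣ lookup b ∣ ζ ⟩ ∘ g ≗ ⟨ lookup a ∣ lookup b ∣ lookup a i VF.∷ ζ ⟩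
      g-ok ζ a b = ∘-⟨⟩ {f = var₁} {var₂} {var₁ i VF.∷ par} ⟨ lookup a ∣ lookup b ∣ ζ ⟩ ⟨⟩-var₁ ⟨⟩-var₂
        λ { zero → ⟨⟩-var₁ i ; (suc l) → ⟨⟩-par l }

    fresh-relDefinable : (s : Fin m → Fin nX) (x : Fin nX) →
                         RelDefinable (λ t ζ a b → x ∉ names (stack s ζ))
    fresh-relDefinable s x = RelDefinable-resp (Dec-relDefinable (x ∉? List.tabulate s))
      λ _ ζ _ _ → cong-⇔ (λ xs → x ∉ xs) (sym (names-stack s ζ))

  Run-relDefinable   : ∀ n {m} (s : Fin m → Fin nX) (p q : State) →
                       RelDefinable (λ t ζ → Run n (stack s ζ) p q)
  Macro-relDefinable : ∀ n {m} (s : Fin m → Fin nX) (p q : State) →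
                       RelDefinable (λ t ζ → Macro n (stack s ζ) p q)
  Call-relDefinable  : ∀ n {m} (s : Fin m → Fin nX) (ins₁ ins₂ : Instruction) (p q : State) →
                       RelDefinable (λ t ζ → Call n (stack s ζ) ins₁ ins₂ p q)

  Run-relDefinable n s p q =
    Star-Transition-relDefinable (λ p q t ζ → Macro n (stack s ζ) p q) (Macro-relDefinable n s) p q

  Macro-relDefinable zero    s p q = Local-relDefinable s p q
  Macro-relDefinable (suc n) s p q = ⊎-relDefinable (Local-relDefinable s p q)
    (∃∈-relDefinable instrs λ ins₁ → ∃∈-relDefinable instrs λ ins₂ → Call-relDefinable n s ins₁ ins₂ p q)

  Call-relDefinable n s (p₁ , χ₁ , p′) (q′ , χ₂ , q₂) p q with dropOf χ₁ | retrieveOf χ₂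
  ... | just (i , x , _) | just (y , _) =
    ×-relDefinable (Dec-relDefinable (p₁ Fin.≟ p)) (×-relDefinable (Dec-relDefinable (q₂ Fin.≟ q))
      (×-relDefinable (Dec-relDefinable (y Fin.≟ x)) (×-relDefinable (fresh-relDefinable s x)
        (headParam-relDefinable i (Run-relDefinable n (x VF.∷ s) p′ q′)))))
  ... | nothing | _       = Dec-relDefinable {A = ⊥} (no λ ())
  ... | just _  | nothing = Dec-relDefinable {A = ⊥} (no λ ())

  Accepting : (t : Tree Σ') → Pos Σ' t → Set
  Accepting t r = Σ State λ p → accept p ≡ true × Run nX [] q₀ p (replicate k r) (replicate k r) ×
                                 (∀ ins → ins ∈ instrs → ¬ Enabled ins p (replicate k r))

  Accepts⇔Accepting : ∀ t → Accepts Σ' 𝒜 t ⇔ Accepting t (root Σ')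
  Accepts⇔Accepting t = Σ-cong-⇔ λ _ → ⇔-id _ ×-⇔ ⟶*⇔Run ×-⇔ Halting⇔

  Accepting-definable : Definable (λ t ρ → Accepting t (ρ zero))
  Accepting-definable = ∃-Fin-definable λ p → ×-definable (Dec-definable (accept p Bool.≟ true))
    (×-definable (runs p) (∀∈-definable instrs (disabled p)))
    where
    at-root : ∀ {t} (ρ : Env t 1) → ρ ∘ (λ _ → zero) ≗ lookup (replicate k (ρ zero))
    at-root ρ i = sym (lookup-replicate i (ρ zero))

    runs : ∀ p → Definable (λ t ρ → Run nX [] q₀ p (replicate k (ρ zero)) (replicate k (ρ zero)))
    runs p = record
      { formula = rename roots (formula dRun)
      ; sat⇔ = λ _ ρ → sat-relInstance dRun roots {ζ = λ ()}
                 (∘-⟨⟩ {f = λ _ → zero} {λ _ → zero} {λ ()} ρ (at-root ρ) (at-root ρ) λ ()) }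
      where
      dRun = Run-relDefinable nX (λ ()) q₀ p

      roots : Fin (k + k + 0) → Fin 1
      roots = ⟨ (λ _ → zero) ∣ (λ _ → zero) ∣ (λ ()) ⟩

    enabled : ∀ χ → Definable (λ t ρ → Σ (Tuple t) λ b → Apply Σ' χ (replicate k (ρ zero)) [] b [])
    enabled χ = record
      { formula = exs k (rename g (formula dApply))
      ; sat⇔ = λ _ ρ → ⇔-trans (Sat-exs k _) (Σ-cong-⇔ λ c → sat-relInstance dApply g (g-ok ρ c)) }
      where
      dApply = Apply-relDefinable {0} (λ ()) χ

      g : Fin (k + k + 0) → Fin (k + 1)
      g = ⟨ (λ _ → k ↑ʳ zero) ∣ (_↑ˡ 1) ∣ (λ ()) ⟩

      g-ok : ∀ {t} (ρ : Env t 1) (c : Tuple t) →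
             (lookup c VF.++ ρ) ∘ g ≗ ⟨ lookup (replicate k (ρ zero)) ∣ lookup c ∣ (λ ()) ⟩
      g-ok ρ c = ∘-⟨⟩ {f = λ _ → k ↑ʳ zero} {_↑ˡ 1} {λ ()} (lookup c VF.++ ρ)
        (λ i → trans (lookup-++ʳ (lookup c) ρ zero) (at-root ρ i)) (lookup-++ˡ (lookup c) ρ) λ ()

    disabled : ∀ p ins → Definable (λ t ρ → ¬ Enabled ins p (replicate k (ρ zero)))
    disabled p (p′ , χ , _) = ¬-definable
      (×-definable (Dec-definable (p′ Fin.≟ p)) (⊎-definable (Dec-definable (T? _)) (enabled χ)))

-- The construction works for every k.
theorem5p5 : (Σ' : RankedAlphabet) (k : ℕ) → 1 ≤ k →
    (𝒜 : Automaton Σ' k) →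
    Σ (Formula Σ' k 0) λ φ →
      (t : Tree Σ') → Accepts Σ' 𝒜 t ⇔ _⊨_ Σ' t φ
theorem5p5 Σ' k _ 𝒜 = formula accepting-at-root , λ t →
  ⇔-trans (Accepts⇔Accepting t) (⇔-sym (⇔-trans (sat⇔ accepting-at-root t (λ ())) at-root))
  where
  open Logic Σ' k
  open Automata Σ' k 𝒜
  open Definable

  accepting-at-root : Definable (λ t ρ → Σ (Pos Σ' t) λ r → r ≡ root Σ' × Accepting t r)
  accepting-at-root = ∃-definable (×-definable (root-definable zero) Accepting-definable)

  at-root : ∀ {t} → (Σ (Pos Σ' t) λ r → r ≡ root Σ' × Accepting t r) ⇔ Accepting t (root Σ')
  at-root = mk⇔ (λ { (_ , refl , acc) → acc }) (λ acc → _ , refl , acc)
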